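{- For an integer $v\ge1$ let $K=\lfloor\log v/\log 2\rfloor$ and \[ \mathcal{C}_v(K)=\max_{w\le v}\ \max_{\substack{a_0,\dots,a_K\\ w+a_0+\dots+a_K\le v\\ a_j\le v2^{ -j}\ \forall j\ge0}}\binom vw\prod_{0\le k\le K}\binom v{a_k}, \] where $w,a_0,\dots,a_K$ range over nonnegative integers. Then $\mathcal{C}_v(K)\le A^v$ with $A=16\sqrt{2e}$. -}

module Defs where

open import Data.Nat using (ℕ; zero; suc; _+_; _*_; _^_; _<_)
open import Data.Nat using (_!)
open import Data.Fin using (Fin; zero; suc)
open import Data.Product using (∃-syntax)

sumFin : ∀ {n} → (Fin n → ℕ) → ℕ
sumFin {zero}  f = 0
sumFin {suc n} f = f zero + sumFin (λ i → f (suc i))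

prodFin : ∀ {n} → (Fin n → ℕ) → ℕ
prodFin {zero}  f = 1
prodFin {suc n} f = f zero * prodFin (λ i → f (suc i))

-- expTimesFact v N = N! * Σ_{k=0}^{N} v^k / k!   (a natural number)
expTimesFact : ℕ → ℕ → ℕ
expTimesFact v zero    = 1
expTimesFact v (suc N) = suc N * expTimesFact v N + v ^ suc N

-- c ≤ A^v with A = 16 √(2e), i.e. c² ≤ 512^v e^v.  Since e^v is irrational
-- (v ≥ 1) this is equivalent to c² < 512^v e^v, i.e. to the existence of a
-- partial sum S_N = Σ_{k≤N} v^k/k! of e^v with c² < 512^v S_N,
-- written here multiplied through by N!.
LeA^ : ℕ → ℕ → Set
LeA^ c v = ∃[ N ] (c * c * (N !) < 512 ^ v * expTimesFact v N)

{-# OPTIONS --safe #-}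
module Submission where

-- Let s = Σ aₖ and c = C(v,w) ∏ C(v,aₖ).  Since C(v,aₖ) aₖ! ≤ v^aₖ and the
-- multinomial coefficient s! / ∏ aₖ! = ∏ₖ C(aₖ + … + a_K, aₖ) is at most 2^T with
-- T = Σ (k+1) aₖ, we get s! ∏ C(v,aₖ) ≤ v^s 2^T.  The caps aₖ ≤ v / 2^k give
-- 2T ≤ 3(v + s), because 2T − 3s = −a₀ + Σ_{k≥1} (2k−1) aₖ and Σ_{k≥1} (2k−1)/2^k = 3;
-- and C(v,w) 7^s ≤ C(v,w) 7^(v−w) ≤ 8^v.  Together with (2s)! ≤ 4^s (s!)² and 32 ≤ 49
-- this gives c² (2s)! ≤ 512^v v^(2s), hence c² < 512^v e^v.

open import Data.Fin using (Fin; zero; suc; toℕ)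
open import Data.Nat
open import Data.Nat.Combinatorics
open import Data.Nat.DivMod using (m/n*n≡m)
open import Data.Nat.Logarithm using (⌊log₂_⌋)
open import Data.Nat.Properties
open import Algebra.Properties.CommutativeSemigroup *-commutativeSemigroup
  using (interchange; x∙yz≈y∙xz)
open import Algebra.Properties.Semiring.Sum +-*-semiring
  using (sum; sum-cong-≗; ∑-distrib-+; *-distribˡ-sum)
open import Data.Nat.Tactic.RingSolver using (solve-∀)
open import Data.Product using (_,_)
open import Data.Vec.Functional using (tail)
open import Function using (_∘_)
open import Relation.Binary.PropositionalEquality
open import Relation.Nullary using (yes; no)

open import Defs

[m*n]^o≡m^o*n^o : ∀ m n o → (m * n) ^ o ≡ m ^ o * n ^ o
[m*n]^o≡m^o*n^o m n zero    = refl
[m*n]^o≡m^o*n^o m n (suc o) = begin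
  m * n * (m * n) ^ o       ≡⟨ cong (m * n *_) ([m*n]^o≡m^o*n^o m n o) ⟩
  m * n * (m ^ o * n ^ o)   ≡⟨ interchange m n (m ^ o) (n ^ o) ⟩
  m * m ^ o * (n * n ^ o)   ∎
  where open ≡-Reasoning

[m+n]Cm*[m!*n!]≡[m+n]! : ∀ m n → ((m + n) C m) * (m ! * n !) ≡ (m + n) !
[m+n]Cm*[m!*n!]≡[m+n]! m n = begin
  ((m + n) C m) * (m ! * n !)   ≡⟨ cong (λ k → ((m + n) C m) * (m ! * k !)) (sym (m+n∸m≡n m n)) ⟩
  ((m + n) C m) * d             ≡⟨ cong (_* d) (nCk≡n!/k![n-k]! (m≤m+n m n)) ⟩
  ((m + n) ! / d) * d           ≡⟨ m/n*n≡m (k![n∸k]!∣n! (m≤m+n m n)) ⟩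
  (m + n) !                     ∎
  where
  open ≡-Reasoning
  d = m ! * (m + n ∸ m) !
  instance _ = m !* (m + n ∸ m) !≢0

nCk*m^[n∸k]≤[1+m]^n : ∀ m n k → (n C k) * m ^ (n ∸ k) ≤ suc m ^ n
nCk*m^[n∸k]≤[1+m]^n m zero    zero    = ≤-refl
nCk*m^[n∸k]≤[1+m]^n m zero    (suc k) = z≤n
nCk*m^[n∸k]≤[1+m]^n m (suc n) zero    =
  ≤-trans (≤-reflexive (*-identityˡ (m ^ suc n))) (^-monoˡ-≤ (suc n) (n≤1+n m))
nCk*m^[n∸k]≤[1+m]^n m (suc n) (suc k) = begin
  (suc n C suc k) * m ^ (n ∸ k)
    ≡⟨ cong (_* m ^ (n ∸ k)) (sym (nCk+nC[k+1]≡[n+1]C[k+1] n k)) ⟩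
  (n C k + n C suc k) * m ^ (n ∸ k)
    ≡⟨ *-distribʳ-+ (m ^ (n ∸ k)) (n C k) (n C suc k) ⟩
  (n C k) * m ^ (n ∸ k) + (n C suc k) * m ^ (n ∸ k)
    ≤⟨ +-mono-≤ (nCk*m^[n∸k]≤[1+m]^n m n k) upper ⟩
  suc m ^ n + m * suc m ^ n
    ∎
  where
  open ≤-Reasoning
  upper : (n C suc k) * m ^ (n ∸ k) ≤ m * suc m ^ n
  upper with suc k ≤? n
  ... | yes k<n = begin
    (n C suc k) * m ^ (n ∸ k)             ≡⟨ cong (λ e → (n C suc k) * m ^ e) (+-∸-assoc 1 k<n) ⟩
    (n C suc k) * (m * m ^ (n ∸ suc k))   ≡⟨ x∙yz≈y∙xz (n C suc k) m (m ^ (n ∸ suc k)) ⟩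
    m * ((n C suc k) * m ^ (n ∸ suc k))   ≤⟨ *-monoʳ-≤ m (nCk*m^[n∸k]≤[1+m]^n m n (suc k)) ⟩
    m * suc m ^ n                         ∎
  ... | no k≮n = ≤-trans (≤-reflexive (cong (_* m ^ (n ∸ k)) (k>n⇒nCk≡0 (≰⇒> k≮n)))) z≤n

nCk*m^j≤[1+m]^n : ∀ m .{{_ : NonZero m}} n k {j} → k + j ≤ n → (n C k) * m ^ j ≤ suc m ^ n
nCk*m^j≤[1+m]^n m n k {j} k+j≤n = ≤-trans
  (*-monoʳ-≤ (n C k) (^-monoʳ-≤ m (m+n≤o⇒m≤o∸n j (subst (_≤ n) (+-comm k j) k+j≤n))))
  (nCk*m^[n∸k]≤[1+m]^n m n k)

nCk≤2^n : ∀ n k → n C k ≤ 2 ^ n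
nCk≤2^n n k = begin
  n C k                   ≡⟨ sym (*-identityʳ (n C k)) ⟩
  (n C k) * 1             ≡⟨ cong ((n C k) *_) (sym (^-zeroˡ (n ∸ k))) ⟩
  (n C k) * 1 ^ (n ∸ k)   ≤⟨ nCk*m^[n∸k]≤[1+m]^n 1 n k ⟩
  2 ^ n                   ∎
  where open ≤-Reasoning

[n+n]!≤2^n*2^n*[n!*n!] : ∀ n → (n + n) ! ≤ 2 ^ n * 2 ^ n * (n ! * n !)
[n+n]!≤2^n*2^n*[n!*n!] n = begin
  (n + n) !                     ≡⟨ sym ([m+n]Cm*[m!*n!]≡[m+n]! n n) ⟩
  ((n + n) C n) * (n ! * n !)   ≤⟨ *-monoˡ-≤ (n ! * n !) (nCk≤2^n (n + n) n) ⟩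
  2 ^ (n + n) * (n ! * n !)     ≡⟨ cong (_* (n ! * n !)) (^-distribˡ-+-* 2 n n) ⟩
  2 ^ n * 2 ^ n * (n ! * n !)   ∎
  where open ≤-Reasoning

[m+n]!≤[m+n]^m*n! : ∀ m n → (m + n) ! ≤ (m + n) ^ m * n !
[m+n]!≤[m+n]^m*n! zero    n = ≤-reflexive (sym (*-identityˡ (n !)))
[m+n]!≤[m+n]^m*n! (suc m) n = begin
  suc (m + n) * (m + n) !
    ≤⟨ *-monoʳ-≤ (suc (m + n)) ([m+n]!≤[m+n]^m*n! m n) ⟩
  suc (m + n) * ((m + n) ^ m * n !)
    ≤⟨ *-monoʳ-≤ (suc (m + n)) (*-monoˡ-≤ (n !) (^-monoˡ-≤ m (n≤1+n (m + n)))) ⟩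
  suc (m + n) * (suc (m + n) ^ m * n !)
    ≡⟨ sym (*-assoc (suc (m + n)) (suc (m + n) ^ m) (n !)) ⟩
  suc (m + n) ^ suc m * n !
    ∎
  where open ≤-Reasoning

[m+n]Cm*m!≤[m+n]^m : ∀ m n → ((m + n) C m) * m ! ≤ (m + n) ^ m
[m+n]Cm*m!≤[m+n]^m m n = *-cancelʳ-≤ _ _ (n !) {{n !≢0}} (begin
  ((m + n) C m) * m ! * n !     ≡⟨ *-assoc ((m + n) C m) (m !) (n !) ⟩
  ((m + n) C m) * (m ! * n !)   ≡⟨ [m+n]Cm*[m!*n!]≡[m+n]! m n ⟩
  (m + n) !                     ≤⟨ [m+n]!≤[m+n]^m*n! m n ⟩
  (m + n) ^ m * n !             ∎)
  where open ≤-Reasoning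

nCk*k!≤n^k : ∀ n k → (n C k) * k ! ≤ n ^ k
nCk*k!≤n^k n k with k ≤? n
... | yes k≤n = subst (λ n → (n C k) * k ! ≤ n ^ k) (m+[n∸m]≡n k≤n) ([m+n]Cm*m!≤[m+n]^m k (n ∸ k))
... | no k≰n  = ≤-trans (≤-reflexive (cong (_* k !) (k>n⇒nCk≡0 (≰⇒> k≰n)))) z≤n

sumFin≡sum : ∀ {n} (f : Fin n → ℕ) → sumFin f ≡ sum f
sumFin≡sum {zero}  f = refl
sumFin≡sum {suc n} f = cong (f zero +_) (sumFin≡sum (tail f))

sumFin-cong : ∀ {n} {f g : Fin n → ℕ} → f ≗ g → sumFin f ≡ sumFin g
sumFin-cong {f = f} {g} f≗g = trans (sumFin≡sum f) (trans (sum-cong-≗ f≗g) (sym (sumFin≡sum g)))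

sumFin-distrib-+ : ∀ {n} (f g : Fin n → ℕ) → sumFin (λ i → f i + g i) ≡ sumFin f + sumFin g
sumFin-distrib-+ f g = trans (sumFin≡sum (λ i → f i + g i))
  (trans (∑-distrib-+ f g) (sym (cong₂ _+_ (sumFin≡sum f) (sumFin≡sum g))))

*-distribˡ-sumFin : ∀ {n} m (f : Fin n → ℕ) → m * sumFin f ≡ sumFin (λ i → m * f i)
*-distribˡ-sumFin m f = trans (cong (m *_) (sumFin≡sum f))
  (trans (*-distribˡ-sum m f) (sym (sumFin≡sum ((m *_) ∘ f))))

weightedSum : ∀ {n} → (Fin n → ℕ) → ℕ
weightedSum a = sumFin (λ k → suc (toℕ k) * a k)

oddWeightedSum : ℕ → ∀ {n} → (Fin n → ℕ) → ℕ
oddWeightedSum e b = sumFin (λ j → (2 * (e + toℕ j) + 1) * b j)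

weightedSum-tail : ∀ {n} (a : Fin (suc n) → ℕ) → weightedSum a ≡ sumFin a + weightedSum (tail a)
weightedSum-tail a = begin
  1 * a zero + sumFin (λ k → a (suc k) + suc (toℕ k) * a (suc k))
    ≡⟨ cong₂ _+_ (*-identityˡ (a zero)) (sumFin-distrib-+ (tail a) (λ k → suc (toℕ k) * a (suc k))) ⟩
  a zero + (sumFin (tail a) + weightedSum (tail a))
    ≡⟨ sym (+-assoc (a zero) (sumFin (tail a)) (weightedSum (tail a))) ⟩
  sumFin a + weightedSum (tail a)
    ∎
  where open ≡-Reasoning

oddWeightedSum-tail : ∀ e {n} (b : Fin (suc n) → ℕ) →
  oddWeightedSum e b ≡ (2 * e + 1) * b zero + oddWeightedSum (suc e) (tail b)
oddWeightedSum-tail e b = cong₂ _+_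
  (cong (λ x → (2 * x + 1) * b zero) (+-identityʳ e))
  (sumFin-cong (λ j → cong (λ x → (2 * x + 1) * b (suc j)) (+-suc e (toℕ j))))

2*weightedSum≡sum+oddWeightedSum : ∀ {n} (a : Fin n → ℕ) →
  2 * weightedSum a ≡ sumFin a + oddWeightedSum 0 a
2*weightedSum≡sum+oddWeightedSum a = begin
  2 * weightedSum a                            ≡⟨ *-distribˡ-sumFin 2 (λ k → suc (toℕ k) * a k) ⟩
  sumFin (λ k → 2 * (suc (toℕ k) * a k))       ≡⟨ sumFin-cong (λ k → pointwise (toℕ k) (a k)) ⟩
  sumFin (λ k → a k + (2 * toℕ k + 1) * a k)   ≡⟨ sumFin-distrib-+ a (λ k → (2 * toℕ k + 1) * a k) ⟩
  sumFin a + oddWeightedSum 0 a                ∎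
  where
  open ≡-Reasoning
  pointwise : ∀ k x → 2 * (suc k * x) ≡ x + (2 * k + 1) * x
  pointwise = solve-∀

Capped : ℕ → ℕ → ∀ {n} → (Fin n → ℕ) → Set
Capped v e b = ∀ j → b j * 2 ^ (e + toℕ j) ≤ v

Capped-tail : ∀ {v n} e (b : Fin (suc n) → ℕ) → Capped v e b → Capped v (suc e) (tail b)
Capped-tail {v} e b capped j =
  subst (λ x → b (suc j) * 2 ^ x ≤ v) (+-suc e (toℕ j)) (capped (suc j))

-- Σ_{j≥0} (2(e+j)+1) / 2^(e+1+j) = (4e+6) / 2^(e+1).
oddWeightedSum-bound : ∀ {v n} e (b : Fin n → ℕ) → Capped v (suc e) b →
  2 ^ suc e * oddWeightedSum e b ≤ (4 * e + 6) * v
oddWeightedSum-bound {n = zero}  e b _      = ≤-trans (≤-reflexive (*-zeroʳ (2 ^ suc e))) z≤n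
oddWeightedSum-bound {v} {suc n} e b capped = begin
  Q * oddWeightedSum e b                   ≡⟨ cong (Q *_) (oddWeightedSum-tail e b) ⟩
  Q * ((2 * e + 1) * b zero + X)           ≡⟨ regroup Q e (b zero) X ⟩
  (2 * e + 1) * (b zero * Q) + Q * X       ≤⟨ +-mono-≤ (*-monoʳ-≤ (2 * e + 1) head-bound) tail-bound ⟩
  (2 * e + 1) * v + (2 * e + 5) * v        ≡⟨ collect e v ⟩
  (4 * e + 6) * v                          ∎
  where
  open ≤-Reasoning
  Q = 2 ^ suc e
  X = oddWeightedSum (suc e) (tail b)
  head-bound : b zero * Q ≤ v
  head-bound = subst (λ x → b zero * 2 ^ x ≤ v) (+-identityʳ (suc e)) (capped zero)
  tail-bound : Q * X ≤ (2 * e + 5) * v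
  tail-bound = *-cancelˡ-≤ 2 (begin
    2 * (Q * X)                ≡⟨ sym (*-assoc 2 Q X) ⟩
    2 ^ suc (suc e) * X        ≤⟨ oddWeightedSum-bound (suc e) (tail b) (Capped-tail (suc e) b capped) ⟩
    (4 * suc e + 6) * v        ≡⟨ halve e v ⟩
    2 * ((2 * e + 5) * v)      ∎)
    where
    halve : ∀ e v → (4 * suc e + 6) * v ≡ 2 * ((2 * e + 5) * v)
    halve = solve-∀
  regroup : ∀ Q e x X → Q * ((2 * e + 1) * x + X) ≡ (2 * e + 1) * (x * Q) + Q * X
  regroup = solve-∀
  collect : ∀ e v → (2 * e + 1) * v + (2 * e + 5) * v ≡ (4 * e + 6) * v
  collect = solve-∀

weightedSum-bound : ∀ {v n} (a : Fin n → ℕ) → Capped v 0 a → 2 * weightedSum a ≤ 3 * (v + sumFin a)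
weightedSum-bound {n = zero}  a _      = z≤n
weightedSum-bound {v} {suc n} a capped = begin
  2 * weightedSum a                    ≡⟨ cong (2 *_) (weightedSum-tail a) ⟩
  2 * (s + weightedSum (tail a))       ≡⟨ *-distribˡ-+ 2 s (weightedSum (tail a)) ⟩
  2 * s + 2 * weightedSum (tail a)     ≡⟨ cong (2 * s +_) (2*weightedSum≡sum+oddWeightedSum (tail a)) ⟩
  2 * s + (s′ + oddWeightedSum 0 (tail a))
    ≤⟨ +-monoʳ-≤ (2 * s) (+-mono-≤ (m≤n+m s′ (a zero)) oddWeightedSum≤3v) ⟩
  2 * s + (s + 3 * v)                  ≡⟨ collect s v ⟩
  3 * (v + s)                          ∎
  where
  open ≤-Reasoning
  s = sumFin a
  s′ = sumFin (tail a)
  oddWeightedSum≤3v : oddWeightedSum 0 (tail a) ≤ 3 * v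
  oddWeightedSum≤3v = *-cancelˡ-≤ 2
    (≤-trans (oddWeightedSum-bound 0 (tail a) (Capped-tail 0 a capped)) (≤-reflexive (*-assoc 2 3 v)))
  collect : ∀ s v → 2 * s + (s + 3 * v) ≡ 3 * (v + s)
  collect = solve-∀

∏vCa*[∑a]!≤v^∑a*2^weightedSum : ∀ v {n} (a : Fin n → ℕ) →
  prodFin (λ k → v C a k) * sumFin a ! ≤ v ^ sumFin a * 2 ^ weightedSum a
∏vCa*[∑a]!≤v^∑a*2^weightedSum v {zero}  a = ≤-refl
∏vCa*[∑a]!≤v^∑a*2^weightedSum v {suc n} a = begin
  (v C a₀) * Q′ * (a₀ + s′) !
    ≡⟨ cong ((v C a₀) * Q′ *_) (sym ([m+n]Cm*[m!*n!]≡[m+n]! a₀ s′)) ⟩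
  (v C a₀) * Q′ * (((a₀ + s′) C a₀) * (a₀ ! * s′ !))
    ≡⟨ regroup (v C a₀) Q′ ((a₀ + s′) C a₀) (a₀ !) (s′ !) ⟩
  (v C a₀) * a₀ ! * ((a₀ + s′) C a₀) * (Q′ * s′ !)
    ≤⟨ *-mono-≤ (*-mono-≤ (nCk*k!≤n^k v a₀) (nCk≤2^n (a₀ + s′) a₀))
                (∏vCa*[∑a]!≤v^∑a*2^weightedSum v (tail a)) ⟩
  v ^ a₀ * 2 ^ (a₀ + s′) * (v ^ s′ * 2 ^ t′)
    ≡⟨ interchange (v ^ a₀) (2 ^ (a₀ + s′)) (v ^ s′) (2 ^ t′) ⟩
  v ^ a₀ * v ^ s′ * (2 ^ (a₀ + s′) * 2 ^ t′)
    ≡⟨ sym (cong₂ _*_ (^-distribˡ-+-* v a₀ s′) (^-distribˡ-+-* 2 (a₀ + s′) t′)) ⟩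
  v ^ (a₀ + s′) * 2 ^ (a₀ + s′ + t′)
    ≡⟨ cong (λ t → v ^ (a₀ + s′) * 2 ^ t) (sym (weightedSum-tail a)) ⟩
  v ^ sumFin a * 2 ^ weightedSum a
    ∎
  where
  open ≤-Reasoning
  a₀ = a zero
  s′ = sumFin (tail a)
  t′ = weightedSum (tail a)
  Q′ = prodFin (λ k → v C tail a k)
  regroup : ∀ x y z p q → x * y * (z * (p * q)) ≡ x * p * z * (y * q)
  regroup = solve-∀

2^t*2^t*[2^s*2^s]≤8^v*[7^s*7^s] : ∀ v s t → 2 * t ≤ 3 * (v + s) →
  2 ^ t * 2 ^ t * (2 ^ s * 2 ^ s) ≤ 8 ^ v * (7 ^ s * 7 ^ s)
2^t*2^t*[2^s*2^s]≤8^v*[7^s*7^s] v s t 2t≤3[v+s] = begin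
  2 ^ t * 2 ^ t * (2 ^ s * 2 ^ s)   ≡⟨ sym (cong₂ _*_ (^-distribˡ-+-* 2 t t) (^-distribˡ-+-* 2 s s)) ⟩
  2 ^ (t + t) * 2 ^ (s + s)         ≡⟨ sym (^-distribˡ-+-* 2 (t + t) (s + s)) ⟩
  2 ^ (t + t + (s + s))             ≤⟨ ^-monoʳ-≤ 2 exponent-bound ⟩
  2 ^ (3 * v + 5 * s)               ≡⟨ ^-distribˡ-+-* 2 (3 * v) (5 * s) ⟩
  2 ^ (3 * v) * 2 ^ (5 * s)         ≡⟨ sym (cong₂ _*_ (^-*-assoc 2 3 v) (^-*-assoc 2 5 s)) ⟩
  8 ^ v * 32 ^ s                    ≤⟨ *-monoʳ-≤ (8 ^ v) (^-monoˡ-≤ s (m≤m+n 32 17)) ⟩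
  8 ^ v * 49 ^ s                    ≡⟨ cong (8 ^ v *_) ([m*n]^o≡m^o*n^o 7 7 s) ⟩
  8 ^ v * (7 ^ s * 7 ^ s)           ∎
  where
  open ≤-Reasoning
  exponent-bound : t + t + (s + s) ≤ 3 * v + 5 * s
  exponent-bound = begin
    t + t + (s + s)         ≡⟨ double t s ⟩
    2 * t + 2 * s           ≤⟨ +-monoˡ-≤ (2 * s) 2t≤3[v+s] ⟩
    3 * (v + s) + 2 * s     ≡⟨ collect v s ⟩
    3 * v + 5 * s           ∎
    where
    double : ∀ t s → t + t + (s + s) ≡ 2 * t + 2 * s
    double = solve-∀
    collect : ∀ v s → 3 * (v + s) + 2 * s ≡ 3 * v + 5 * s
    collect = solve-∀

binomialProduct-bound : ∀ v w {n} (a : Fin n → ℕ) → w + sumFin a ≤ v → Capped v 0 a →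
  let c = (v C w) * prodFin (λ k → v C a k)
      s = sumFin a
  in  c * c * (s + s) ! ≤ 512 ^ v * v ^ (s + s)
binomialProduct-bound v w a w+s≤v capped = *-cancelʳ-≤ _ _ (7 ^ s * 7 ^ s) {{7^s*7^s≢0}} (begin
  B * Q * (B * Q) * (s + s) ! * (7 ^ s * 7 ^ s)
    ≤⟨ *-monoˡ-≤ (7 ^ s * 7 ^ s) (*-monoʳ-≤ (B * Q * (B * Q)) ([n+n]!≤2^n*2^n*[n!*n!] s)) ⟩
  B * Q * (B * Q) * (2 ^ s * 2 ^ s * (s ! * s !)) * (7 ^ s * 7 ^ s)
    ≡⟨ regroup₁ B Q (2 ^ s) (s !) (7 ^ s) ⟩
  B * 7 ^ s * (B * 7 ^ s) * (Q * s ! * (Q * s !)) * (2 ^ s * 2 ^ s)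
    ≤⟨ *-monoˡ-≤ (2 ^ s * 2 ^ s) (*-mono-≤ (*-mono-≤ B-bound B-bound) (*-mono-≤ Q-bound Q-bound)) ⟩
  8 ^ v * 8 ^ v * (v ^ s * 2 ^ t * (v ^ s * 2 ^ t)) * (2 ^ s * 2 ^ s)
    ≡⟨ regroup₂ (8 ^ v) (v ^ s) (2 ^ t) (2 ^ s) ⟩
  8 ^ v * 8 ^ v * (v ^ s * v ^ s) * (2 ^ t * 2 ^ t * (2 ^ s * 2 ^ s))
    ≤⟨ *-monoʳ-≤ (8 ^ v * 8 ^ v * (v ^ s * v ^ s))
                 (2^t*2^t*[2^s*2^s]≤8^v*[7^s*7^s] v s t (weightedSum-bound a capped)) ⟩
  8 ^ v * 8 ^ v * (v ^ s * v ^ s) * (8 ^ v * (7 ^ s * 7 ^ s))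
    ≡⟨ regroup₃ (8 ^ v) (v ^ s) (7 ^ s * 7 ^ s) ⟩
  8 ^ v * 8 ^ v * 8 ^ v * (v ^ s * v ^ s) * (7 ^ s * 7 ^ s)
    ≡⟨ cong₂ (λ x y → x * y * (7 ^ s * 7 ^ s)) 8^v*8^v*8^v≡512^v (sym (^-distribˡ-+-* v s s)) ⟩
  512 ^ v * v ^ (s + s) * (7 ^ s * 7 ^ s)
    ∎)
  where
  open ≤-Reasoning
  B = v C w
  Q = prodFin (λ k → v C a k)
  s = sumFin a
  t = weightedSum a
  7^s*7^s≢0 : NonZero (7 ^ s * 7 ^ s)
  7^s*7^s≢0 = m*n≢0 (7 ^ s) (7 ^ s) {{m^n≢0 7 s}} {{m^n≢0 7 s}}
  B-bound : B * 7 ^ s ≤ 8 ^ v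
  B-bound = nCk*m^j≤[1+m]^n 7 v w w+s≤v
  Q-bound : Q * s ! ≤ v ^ s * 2 ^ t
  Q-bound = ∏vCa*[∑a]!≤v^∑a*2^weightedSum v a
  8^v*8^v*8^v≡512^v : 8 ^ v * 8 ^ v * 8 ^ v ≡ 512 ^ v
  8^v*8^v*8^v≡512^v = sym (trans ([m*n]^o≡m^o*n^o 64 8 v) (cong (_* 8 ^ v) ([m*n]^o≡m^o*n^o 8 8 v)))
  regroup₁ : ∀ B Q x y z → B * Q * (B * Q) * (x * x * (y * y)) * (z * z)
                         ≡ B * z * (B * z) * (Q * y * (Q * y)) * (x * x)
  regroup₁ = solve-∀
  regroup₂ : ∀ x y z u → x * x * (y * z * (y * z)) * (u * u) ≡ x * x * (y * y) * (z * z * (u * u))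
  regroup₂ = solve-∀
  regroup₃ : ∀ x y z → x * x * (y * y) * (x * z) ≡ x * x * x * (y * y) * z
  regroup₃ = solve-∀

v^N≤expTimesFact : ∀ v N → v ^ N ≤ expTimesFact v N
v^N≤expTimesFact v zero    = ≤-refl
v^N≤expTimesFact v (suc N) = m≤n+m (v ^ suc N) (suc N * expTimesFact v N)

[1+N]*v^N<expTimesFact : ∀ v N → 0 < v → suc N * v ^ N < expTimesFact v (suc N)
[1+N]*v^N<expTimesFact v N 0<v = begin-strict
  suc N * v ^ N              ≤⟨ *-monoʳ-≤ (suc N) (v^N≤expTimesFact v N) ⟩
  suc N * expTimesFact v N   <⟨ m<m+n _ (m^n>0 v {{>-nonZero 0<v}} (suc N)) ⟩
  expTimesFact v (suc N)     ∎
  where open ≤-Reasoning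

LeA^-intro : ∀ c v N → 0 < v → c * c * N ! ≤ 512 ^ v * v ^ N → LeA^ c v
LeA^-intro c v N 0<v bound = suc N , (begin-strict
  c * c * (suc N * N !)              ≡⟨ x∙yz≈y∙xz (c * c) (suc N) (N !) ⟩
  suc N * (c * c * N !)              ≤⟨ *-monoʳ-≤ (suc N) bound ⟩
  suc N * (512 ^ v * v ^ N)          ≡⟨ x∙yz≈y∙xz (suc N) (512 ^ v) (v ^ N) ⟩
  512 ^ v * (suc N * v ^ N)          <⟨ *-monoʳ-< (512 ^ v) {{m^n≢0 512 v}} ([1+N]*v^N<expTimesFact v N 0<v) ⟩
  512 ^ v * expTimesFact v (suc N)   ∎)
  where open ≤-Reasoning

lemma4p2 : (v : ℕ) → 1 ≤ v →
    (w : ℕ) → (a : Fin (suc ⌊log₂ v ⌋) → ℕ) →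
    w ≤ v → w + sumFin a ≤ v → (∀ j → a j * 2 ^ toℕ j ≤ v) →
    LeA^ ((v C w) * prodFin (λ k → v C a k)) v
lemma4p2 v 1≤v w a _ w+s≤v capped =
  LeA^-intro ((v C w) * prodFin (λ k → v C a k)) v (sumFin a + sumFin a) 1≤v
    (binomialProduct-bound v w a w+s≤v capped)
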